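{- For each $n\ge1$, $$\sum_{\pi\in\mathfrak S_n}(-1)^{\mathrm{exc}(\pi)}=\sum_{\pi\in\mathfrak S_n}(-1)^{\mathrm{exc}_P(\pi)}\quad\text{and}\quad \sum_{\pi\in\mathfrak D_n}(-1)^{\mathrm{exc}(\pi)}=\sum_{\pi\in\mathfrak D_n}(-1)^{\mathrm{exc}_P(\pi)}.$$
   Context: $\mathfrak S_n$ is the set of permutations of $[n]=\{1,\dots,n\}$ and $\mathfrak D_n=\{\pi\in\mathfrak S_n:\pi(i)\ne i\ \forall i\}$ is the set of derangements. $\mathrm{exc}(\pi)=\#\{i\in[n]:\pi(i)>i\}$. An index $i\in[n]$ is an excedance of type $P$ of $\pi$ if either $\pi(i)>i$ and $\pi(i)-i$ is odd, or $\pi(i)<i$ and $\pi(i)-i$ is even; $\mathrm{exc}_P(\pi)$ is the number of such indices. -}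

module Defs where

open import Data.Nat using (ℕ; zero; suc; _<ᵇ_; _∸_; _%_; _≡ᵇ_)
open import Data.Bool using (Bool; true; false; if_then_else_; _∧_; not)
open import Data.Fin using (Fin; toℕ) renaming (_≟_ to _≟ᶠ_)
open import Data.Fin.Properties using () renaming (_≟_ to _≟ᶠ′_)
open import Data.Vec using (Vec; []; _∷_; lookup; toList)
open import Data.List using (List; []; _∷_; map; concatMap; filter; foldr; allFin)
open import Data.Integer using (ℤ; _+_; _^_; -1ℤ; 0ℤ)
open import Relation.Nullary using (¬_; ¬?)
open import Relation.Binary.PropositionalEquality using (_≡_)
open import Data.List.Relation.Unary.All using (All; all?)
import Data.List.Relation.Unary.Unique.DecPropositional as UDec

allVecs : (m n : ℕ) → List (Vec (Fin n) m)
allVecs zero    n = [] ∷ []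
allVecs (suc m) n = concatMap (λ x → map (x ∷_) (allVecs m n)) (allFin n)

-- A permutation of [n] in one-line notation: π(i) = lookup π i (positions/values 0-indexed,
-- which does not affect exc or exc_P since only differences matter).
-- 𝔖 n : every injective map Fin n → Fin n, each listed exactly once.
open module U {n : ℕ} = UDec (_≟ᶠ′_ {n}) using (Unique; unique?)

𝔖 : (n : ℕ) → List (Vec (Fin n) n)
𝔖 n = filter (λ π → unique? (toList π)) (allVecs n n)


𝔇 : (n : ℕ) → List (Vec (Fin n) n)
𝔇 n = filter (λ π → all? (λ i → ¬? (lookup π i ≟ᶠ′ i)) (allFin n)) (𝔖 n)

count : {n : ℕ} → (Fin n → Bool) → ℕ
count {n} p = foldr (λ i acc → if p i then suc acc else acc) 0 (allFin n)

isEven : ℕ → Bool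
isEven k = k % 2 ≡ᵇ 0

exc : {n : ℕ} → Vec (Fin n) n → ℕ
exc π = count (λ i → toℕ i <ᵇ toℕ (lookup π i))

isExcP : {n : ℕ} → Vec (Fin n) n → Fin n → Bool
isExcP π i =
  let a = toℕ (lookup π i) ; b = toℕ i in
  if b <ᵇ a then not (isEven (a ∸ b))
  else if a <ᵇ b then isEven (b ∸ a)
  else false

excP : {n : ℕ} → Vec (Fin n) n → ℕ
excP π = count (isExcP π)

Σℤ : {A : Set} → List A → (A → ℤ) → ℤ
Σℤ L f = foldr (λ x acc → f x + acc) 0ℤ L

{-# OPTIONS --safe #-}

-- Let π^rc(j) = n + 1 − π(n + 1 − j) be the reverse-complement of π; it is an involution of 𝔖_n
-- that maps 𝔇_n to itself.  Position n + 1 − i is an excedance of type P of π^rc exactly when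
-- i − π(i) is odd and positive or even and negative, so for every i the two indicators
-- [π(i) > i] and [n + 1 − i is a type-P excedance of π^rc] differ by the parity of π(i) + i.
-- Since π is a bijection, Σᵢ (π(i) + i) is even, so exc(π) ≡ exc_P(π^rc) (mod 2); summing over
-- the involution π ↦ π^rc gives both identities.

module Submission where

open import Defs
open import Data.Nat using (ℕ; _≥_)
open import Data.Nat as ℕ using (_+_; _∸_; _<ᵇ_)
open import Data.Integer using (_^_; -1ℤ)
open import Data.Product using (_×_)
open import Relation.Binary.PropositionalEquality using (_≡_)

open import Algebra.Bundles using (CommutativeMonoid; CommutativeRing)
import Algebra.Properties.CommutativeSemigroup as CommutativeSemigroupProperties
open import Data.Bool using (Bool; true; false; not; _xor_; if_then_else_)
open import Data.Bool.Properties
  using (not-involutive; xor-same; xor-identityʳ; xor-annihilates-not; xor-∧-commutativeRing)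
open import Data.Empty using (⊥-elim)
open import Data.Fin using (Fin; zero; suc; toℕ; opposite; punchOut)
open import Data.Fin.Properties
  using (any?; suc-injective; 0≢1+n; opposite-prop; opposite-involutive; toℕ≤pred[n];
         punchOut-injective; <⇒notInjective)
  renaming (_≟_ to _≟ᶠ_)
open import Data.Integer as ℤ using (1ℤ)
import Data.Integer.Properties as ℤ
open import Data.List using (List; []; _∷_; _++_; map; foldr; allFin; concatMap; cartesianProductWith)
open import Data.List.Membership.Propositional using (_∈_)
open import Data.List.Membership.Propositional.Properties
  using (∈-map⁺; ∈-map⁻; ∈-filter⁺; ∈-filter⁻; ∈-allFin; ∈-cartesianProductWith⁺)
open import Data.List.Membership.Propositional.Properties.WithK using (unique∧set⇒bag)
open import Data.List.Relation.Binary.BagAndSetEquality using (∼bag⇒↭)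
import Data.List.Relation.Binary.Permutation.Propositional as ↭
open ↭ using (_↭_)
open import Data.List.Relation.Unary.All as All using (All; []; _∷_; all?)
open import Data.List.Relation.Unary.Any using (here; there)
open import Data.List.Relation.Unary.Unique.Propositional using (Unique; []; _∷_)
import Data.List.Relation.Unary.Unique.Propositional.Properties as Unique
open import Data.Nat.Properties using (+-comm; m+[n∸m]≡n; m+n∸n≡m; +-suc; n<1+n)
open import Data.Product using (_,_; ∃; proj₁; proj₂)
open import Data.Vec using (Vec; []; _∷_; lookup; toList; tabulate)
import Data.Vec.Properties as Vec
import Data.Vec.Relation.Unary.All.Properties as VecAll
open import Function using (_∘_; mk⇔)
open import Function.Definitions using (Injective)
open import Relation.Binary.PropositionalEquality
  using (refl; sym; trans; cong; subst; _≢_; module ≡-Reasoning)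
open import Relation.Nullary using (Dec; yes; no; ¬?)

module BigSum {c ℓ} (M : CommutativeMonoid c ℓ) where
  open CommutativeMonoid M renaming (refl to ≈-refl; sym to ≈-sym; trans to ≈-trans)
  open CommutativeSemigroupProperties commutativeSemigroup using (interchange)
  open import Relation.Binary.Reasoning.Setoid setoid

  ∑ : {A : Set} → List A → (A → Carrier) → Carrier
  ∑ xs f = foldr (λ x acc → f x ∙ acc) ε xs

  module _ {A : Set} where

    ∑-cong : (xs : List A) {f g : A → Carrier} →
             (∀ {x} → x ∈ xs → f x ≈ g x) → ∑ xs f ≈ ∑ xs g
    ∑-cong []       f≈g = ≈-refl
    ∑-cong (x ∷ xs) f≈g = ∙-cong (f≈g (here refl)) (∑-cong xs (f≈g ∘ there))

    ∑-map : {B : Set} (g : A → B) (xs : List A) (f : B → Carrier) →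
            ∑ (map g xs) f ≡ ∑ xs (f ∘ g)
    ∑-map g []       f = refl
    ∑-map g (x ∷ xs) f = cong (f (g x) ∙_) (∑-map g xs f)

    ∑-↭ : {xs ys : List A} (f : A → Carrier) → xs ↭ ys → ∑ xs f ≈ ∑ ys f
    ∑-↭ f ↭.refl       = ≈-refl
    ∑-↭ f (↭.prep x p) = ∙-congˡ (∑-↭ f p)
    ∑-↭ f (↭.swap {xs} {ys} x y p) = begin
      f x ∙ (f y ∙ ∑ xs f) ≈⟨ assoc (f x) (f y) (∑ xs f) ⟨
      (f x ∙ f y) ∙ ∑ xs f ≈⟨ ∙-cong (comm (f x) (f y)) (∑-↭ f p) ⟩
      (f y ∙ f x) ∙ ∑ ys f ≈⟨ assoc (f y) (f x) (∑ ys f) ⟩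
      f y ∙ (f x ∙ ∑ ys f) ∎
    ∑-↭ f (↭.trans p q) = ≈-trans (∑-↭ f p) (∑-↭ f q)

    ∑-∙ : (xs : List A) (f g : A → Carrier) → ∑ xs (λ x → f x ∙ g x) ≈ ∑ xs f ∙ ∑ xs g
    ∑-∙ []       f g = ≈-sym (identityˡ ε)
    ∑-∙ (x ∷ xs) f g = begin
      (f x ∙ g x) ∙ ∑ xs (λ x → f x ∙ g x) ≈⟨ ∙-congˡ (∑-∙ xs f g) ⟩
      (f x ∙ g x) ∙ (∑ xs f ∙ ∑ xs g)      ≈⟨ interchange (f x) (g x) (∑ xs f) (∑ xs g) ⟩
      (f x ∙ ∑ xs f) ∙ (g x ∙ ∑ xs g)      ∎

    ∑-reindex : {xs : List A} {g : A → A} (f : A → Carrier) → map g xs ↭ xs →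
                ∑ xs (f ∘ g) ≈ ∑ xs f
    ∑-reindex {xs} {g} f p = ≈-trans (reflexive (sym (∑-map g xs f))) (∑-↭ f p)

module ⊕ = BigSum (CommutativeRing.+-commutativeMonoid xor-∧-commutativeRing)
-- Σℤ xs f from Defs is definitionally Σ.∑ xs f.
module Σ = BigSum ℤ.+-0-commutativeMonoid

map-↭ : {A : Set} {xs : List A} {f : A → A} → Unique xs → Injective _≡_ _≡_ f →
        (∀ {x} → x ∈ xs → f x ∈ xs) → (∀ {y} → y ∈ xs → ∃ λ x → x ∈ xs × f x ≡ y) →
        map f xs ↭ xs
map-↭ {f = f} xs! f-inj into onto =
  ∼bag⇒↭ (unique∧set⇒bag (Unique.map⁺ f-inj xs!) xs! (mk⇔ image⊆ ⊆image))
  where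
  image⊆ : ∀ {y} → y ∈ map f _ → y ∈ _
  image⊆ y∈ with x , x∈ , refl ← ∈-map⁻ f y∈ = into x∈
  ⊆image : ∀ {y} → y ∈ _ → y ∈ map f _
  ⊆image y∈ with x , x∈ , refl ← onto y∈ = ∈-map⁺ f x∈

map-involution-↭ : {A : Set} {xs : List A} {f : A → A} → Unique xs →
                   (∀ x → f (f x) ≡ x) → (∀ {x} → x ∈ xs → f x ∈ xs) → map f xs ↭ xs
map-involution-↭ {f = f} xs! f∘f≡id into = map-↭ xs! f-inj into (λ y∈ → _ , into y∈ , f∘f≡id _)
  where
  f-inj : Injective _≡_ _≡_ f
  f-inj {x} {y} eq = trans (sym (f∘f≡id x)) (trans (cong f eq) (f∘f≡id y))

injective⇒surjective : {n : ℕ} {f : Fin n → Fin n} → Injective _≡_ _≡_ f → ∀ y → ∃ λ x → f x ≡ y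
injective⇒surjective {ℕ.suc m} {f} f-inj y with any? (λ x → f x ≟ᶠ y)
... | yes hit  = hit
... | no miss = ⊥-elim (<⇒notInjective (n<1+n m) punched-injective)
  where
  y≢f : ∀ x → y ≢ f x
  y≢f x y≡fx = miss (x , sym y≡fx)
  punched-injective : Injective _≡_ _≡_ (λ x → punchOut (y≢f x))
  punched-injective eq = f-inj (punchOut-injective (y≢f _) (y≢f _) eq)

allFin-map-↭ : {n : ℕ} {f : Fin n → Fin n} → Injective _≡_ _≡_ f → map f (allFin n) ↭ allFin n
allFin-map-↭ {n} f-inj = map-↭ (Unique.allFin⁺ n) f-inj (λ _ → ∈-allFin _) onto
  where
  onto : ∀ {y} → y ∈ allFin n → ∃ λ x → x ∈ allFin n × _ ≡ y
  onto {y} _ with x , fx≡y ← injective⇒surjective f-inj y = x , ∈-allFin x , fx≡y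

odd : ℕ → Bool
odd ℕ.zero    = false
odd (ℕ.suc n) = not (odd n)

isEven≡not-odd : ∀ n → isEven n ≡ not (odd n)
isEven≡not-odd 0                   = refl
isEven≡not-odd 1                   = refl
isEven≡not-odd (ℕ.suc (ℕ.suc n)) = trans (isEven≡not-odd n) (cong not (sym (not-involutive (odd n))))

-1^-odd : ∀ n → -1ℤ ^ n ≡ (if odd n then -1ℤ else 1ℤ)
-1^-odd ℕ.zero = refl
-1^-odd (ℕ.suc n) with odd n | -1^-odd n
... | true  | eq = cong (-1ℤ ℤ.*_) eq
... | false | eq = cong (-1ℤ ℤ.*_) eq

-1^-cong-odd : ∀ {m n} → odd m ≡ odd n → -1ℤ ^ m ≡ -1ℤ ^ n
-1^-cong-odd {m} {n} eq =
  trans (-1^-odd m) (trans (cong (λ b → if b then -1ℤ else 1ℤ) eq) (sym (-1^-odd n)))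

odd-count : ∀ {n} (p : Fin n → Bool) → odd (count p) ≡ ⊕.∑ (allFin n) p
odd-count {n} p = go (allFin n)
  where
  go : ∀ xs → odd (foldr (λ i acc → if p i then ℕ.suc acc else acc) 0 xs) ≡ ⊕.∑ xs p
  go []       = refl
  go (x ∷ xs) with p x
  ... | true  = cong not (go xs)
  ... | false = go xs

isExcPℕ : (i v : ℕ) → Bool
isExcPℕ i v = if i <ᵇ v then not (isEven (v ∸ i)) else if v <ᵇ i then isEven (i ∸ v) else false

n<ᵇn≡false : ∀ n → (n <ᵇ n) ≡ false
n<ᵇn≡false ℕ.zero    = refl
n<ᵇn≡false (ℕ.suc n) = n<ᵇn≡false n

n<ᵇ1+m+n≡true : ∀ m n → (n <ᵇ ℕ.suc m + n) ≡ true
n<ᵇ1+m+n≡true m ℕ.zero    = refl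
n<ᵇ1+m+n≡true m (ℕ.suc n) rewrite +-suc m n = n<ᵇ1+m+n≡true m n

m+n<ᵇn≡false : ∀ m n → (m + n <ᵇ n) ≡ false
m+n<ᵇn≡false m ℕ.zero    = refl
m+n<ᵇn≡false m (ℕ.suc n) rewrite +-suc m n = m+n<ᵇn≡false m n

-- Both tests depend only on the signed difference v′ − i′ = i − v.
isExcPℕ-reflect : ∀ v i {i′ v′} → v + v′ ≡ i + i′ → isExcPℕ i′ v′ ≡ isExcPℕ v i
isExcPℕ-reflect ℕ.zero ℕ.zero {i′} refl rewrite n<ᵇn≡false i′ = refl
isExcPℕ-reflect ℕ.zero (ℕ.suc i) {i′} refl
  rewrite n<ᵇ1+m+n≡true i i′ | m+n∸n≡m (ℕ.suc i) i′ = refl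
isExcPℕ-reflect (ℕ.suc v) ℕ.zero {v′ = v′} refl
  rewrite m+n<ᵇn≡false (ℕ.suc v) v′ | n<ᵇ1+m+n≡true v v′ | m+n∸n≡m (ℕ.suc v) v′ = refl
isExcPℕ-reflect (ℕ.suc v) (ℕ.suc i) eq = isExcPℕ-reflect v i (cong ℕ.pred eq)

isExcPℕ≡<ᵇ-xor-odd : ∀ v i → isExcPℕ v i ≡ (i <ᵇ v) xor (odd i xor odd v)
isExcPℕ≡<ᵇ-xor-odd ℕ.zero ℕ.zero = refl
isExcPℕ≡<ᵇ-xor-odd ℕ.zero (ℕ.suc i) = begin
  not (isEven (ℕ.suc i))  ≡⟨ cong not (isEven≡not-odd (ℕ.suc i)) ⟩
  not (not (odd (ℕ.suc i))) ≡⟨ not-involutive _ ⟩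
  odd (ℕ.suc i)           ≡⟨ xor-identityʳ _ ⟨
  odd (ℕ.suc i) xor false ∎
  where open ≡-Reasoning
isExcPℕ≡<ᵇ-xor-odd (ℕ.suc v) ℕ.zero = isEven≡not-odd (ℕ.suc v)
isExcPℕ≡<ᵇ-xor-odd (ℕ.suc v) (ℕ.suc i) =
  trans (isExcPℕ≡<ᵇ-xor-odd v i) (cong ((i <ᵇ v) xor_) (sym (xor-annihilates-not (odd i) (odd v))))

Unique-toList⇒lookup-injective : {A : Set} {n : ℕ} {v : Vec A n} →
                                 Unique (toList v) → Injective _≡_ _≡_ (lookup v)
Unique-toList⇒lookup-injective {v = x ∷ v} (x∉v ∷ v!) {zero}  {zero}  _  = refl
Unique-toList⇒lookup-injective {v = x ∷ v} (x∉v ∷ v!) {zero}  {suc j} eq =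
  ⊥-elim (VecAll.lookup⁺ (VecAll.toList⁻ x∉v) j eq)
Unique-toList⇒lookup-injective {v = x ∷ v} (x∉v ∷ v!) {suc i} {zero}  eq =
  ⊥-elim (VecAll.lookup⁺ (VecAll.toList⁻ x∉v) i (sym eq))
Unique-toList⇒lookup-injective {v = x ∷ v} (x∉v ∷ v!) {suc i} {suc j} eq =
  cong suc (Unique-toList⇒lookup-injective v! eq)

lookup-injective⇒Unique-toList : {A : Set} {n : ℕ} {v : Vec A n} →
                                 Injective _≡_ _≡_ (lookup v) → Unique (toList v)
lookup-injective⇒Unique-toList {v = []}    _   = []
lookup-injective⇒Unique-toList {v = x ∷ v} inj =
  VecAll.toList⁺ (VecAll.lookup⁻ (λ j → 0≢1+n ∘ inj)) ∷
  lookup-injective⇒Unique-toList (suc-injective ∘ inj)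

reverseComplement : {n : ℕ} → Vec (Fin n) n → Vec (Fin n) n
reverseComplement π = tabulate (λ j → opposite (lookup π (opposite j)))

lookup-reverseComplement : {n : ℕ} (π : Vec (Fin n) n) (j : Fin n) →
                           lookup (reverseComplement π) j ≡ opposite (lookup π (opposite j))
lookup-reverseComplement π j = Vec.lookup∘tabulate _ j

reverseComplement-involutive : {n : ℕ} (π : Vec (Fin n) n) → reverseComplement (reverseComplement π) ≡ π
reverseComplement-involutive π = trans (Vec.tabulate-cong twice) (Vec.tabulate∘lookup π)
  where
  open ≡-Reasoning
  twice : ∀ j → opposite (lookup (reverseComplement π) (opposite j)) ≡ lookup π j
  twice j = begin
    opposite (lookup (reverseComplement π) (opposite j))
      ≡⟨ cong opposite (lookup-reverseComplement π (opposite j)) ⟩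
    opposite (opposite (lookup π (opposite (opposite j))))
      ≡⟨ opposite-involutive _ ⟩
    lookup π (opposite (opposite j))
      ≡⟨ cong (lookup π) (opposite-involutive j) ⟩
    lookup π j
      ∎

opposite-injective : {n : ℕ} → Injective _≡_ _≡_ (opposite {n})
opposite-injective {x = i} {j} eq =
  trans (sym (opposite-involutive i)) (trans (cong opposite eq) (opposite-involutive j))

reverseComplement-injective : {n : ℕ} {π : Vec (Fin n) n} → Injective _≡_ _≡_ (lookup π) →
                              Injective _≡_ _≡_ (lookup (reverseComplement π))
reverseComplement-injective {π = π} π-inj {i} {j} eq =
  opposite-injective (π-inj (opposite-injective
    (trans (sym (lookup-reverseComplement π i)) (trans eq (lookup-reverseComplement π j)))))

reverseComplement-fixedPoint : {n : ℕ} (π : Vec (Fin n) n) (j : Fin n) →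
                          lookup (reverseComplement π) j ≡ j → lookup π (opposite j) ≡ opposite j
reverseComplement-fixedPoint π j eq = trans (sym (opposite-involutive _))
  (cong opposite (trans (sym (lookup-reverseComplement π j)) eq))

toℕ+toℕ-opposite : {m : ℕ} (k : Fin (ℕ.suc m)) → toℕ k + toℕ (opposite k) ≡ m
toℕ+toℕ-opposite k = trans (cong (toℕ k +_) (opposite-prop k)) (m+[n∸m]≡n (toℕ≤pred[n] k))

isExcP-reverseComplement : {m : ℕ} (π : Vec (Fin (ℕ.suc m)) (ℕ.suc m)) (j : Fin (ℕ.suc m)) →
  isExcP (reverseComplement π) j ≡ isExcPℕ (toℕ (lookup π (opposite j))) (toℕ (opposite j))
isExcP-reverseComplement π j rewrite lookup-reverseComplement π j =
  isExcPℕ-reflect v i (trans (toℕ+toℕ-opposite k) (sym (trans (+-comm i (toℕ j)) (toℕ+toℕ-opposite j))))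
  where
  k = lookup π (opposite j)
  v = toℕ k
  i = toℕ (opposite j)

odd-excP∘reverseComplement : {m : ℕ} (π : Vec (Fin (ℕ.suc m)) (ℕ.suc m)) →
                             Injective _≡_ _≡_ (lookup π) →
                             odd (excP (reverseComplement π)) ≡ odd (exc π)
odd-excP∘reverseComplement {m} π π-inj = begin
  odd (excP (reverseComplement π))
    ≡⟨ odd-count (isExcP (reverseComplement π)) ⟩
  ⊕ (isExcP (reverseComplement π))
    ≡⟨ ⊕.∑-cong (allFin _) {g = swappedExcP ∘ opposite} (λ {j} _ → isExcP-reverseComplement π j) ⟩
  ⊕ (swappedExcP ∘ opposite)
    ≡⟨ ⊕.∑-reindex swappedExcP (allFin-map-↭ opposite-injective) ⟩
  ⊕ swappedExcP
    ≡⟨ ⊕.∑-cong (allFin _) {f = swappedExcP} (λ {i} _ → isExcPℕ≡<ᵇ-xor-odd (toℕ (lookup π i)) (toℕ i)) ⟩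
  ⊕ (λ i → isExc i xor (oddᶠ i xor oddᶠ (lookup π i)))
    ≡⟨ ⊕.∑-∙ (allFin _) isExc (λ i → oddᶠ i xor oddᶠ (lookup π i)) ⟩
  ⊕ isExc xor ⊕ (λ i → oddᶠ i xor oddᶠ (lookup π i))
    ≡⟨ cong (⊕ isExc xor_) (⊕.∑-∙ (allFin _) oddᶠ (oddᶠ ∘ lookup π)) ⟩
  ⊕ isExc xor (⊕ oddᶠ xor ⊕ (oddᶠ ∘ lookup π))
    ≡⟨ cong (λ b → ⊕ isExc xor (⊕ oddᶠ xor b)) (⊕.∑-reindex oddᶠ (allFin-map-↭ π-inj)) ⟩
  ⊕ isExc xor (⊕ oddᶠ xor ⊕ oddᶠ)
    ≡⟨ cong (⊕ isExc xor_) (xor-same (⊕ oddᶠ)) ⟩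
  ⊕ isExc xor false
    ≡⟨ xor-identityʳ (⊕ isExc) ⟩
  ⊕ isExc
    ≡⟨ odd-count isExc ⟨
  odd (exc π)
    ∎
  where
  open ≡-Reasoning
  ⊕ : (Fin (ℕ.suc m) → Bool) → Bool
  ⊕ = ⊕.∑ (allFin _)
  isExc swappedExcP oddᶠ : Fin (ℕ.suc m) → Bool
  isExc i       = toℕ i <ᵇ toℕ (lookup π i)
  swappedExcP i = isExcPℕ (toℕ (lookup π i)) (toℕ i)
  oddᶠ i        = odd (toℕ i)

concatMap-map≡cartesianProductWith : {A B C : Set} (f : A → B → C) (xs : List A) (ys : List B) →
                                     concatMap (λ x → map (f x) ys) xs ≡ cartesianProductWith f xs ys
concatMap-map≡cartesianProductWith f []       ys = refl
concatMap-map≡cartesianProductWith f (x ∷ xs) ys =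
  cong (map (f x) ys ++_) (concatMap-map≡cartesianProductWith f xs ys)

allVecs-unique : ∀ m n → Unique (allVecs m n)
allVecs-unique ℕ.zero    n = [] ∷ []
allVecs-unique (ℕ.suc m) n =
  subst Unique (sym (concatMap-map≡cartesianProductWith _∷_ (allFin n) (allVecs m n)))
    (Unique.cartesianProductWith⁺ _∷_ Vec.∷-injective (Unique.allFin⁺ n) (allVecs-unique m n))

∈-allVecs : ∀ {m n} (v : Vec (Fin n) m) → v ∈ allVecs m n
∈-allVecs []      = here refl
∈-allVecs {ℕ.suc m} {n} (x ∷ v) =
  subst (x ∷ v ∈_) (sym (concatMap-map≡cartesianProductWith _∷_ (allFin n) (allVecs m n)))
    (∈-cartesianProductWith⁺ _∷_ (∈-allFin x) (∈-allVecs v))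

module _ {n : ℕ} where

  private
    isPermutation? : (π : Vec (Fin n) n) → Dec (Unique (toList π))
    isPermutation? π = U.unique? (toList π)

    isDerangement? : (π : Vec (Fin n) n) → Dec (All (λ i → lookup π i ≢ i) (allFin n))
    isDerangement? π = all? (λ i → ¬? (lookup π i ≟ᶠ i)) (allFin n)

  𝔖-unique : Unique (𝔖 n)
  𝔖-unique = Unique.filter⁺ isPermutation? (allVecs-unique n n)

  𝔇-unique : Unique (𝔇 n)
  𝔇-unique = Unique.filter⁺ isDerangement? 𝔖-unique

  ∈𝔖⁺ : {π : Vec (Fin n) n} → Injective _≡_ _≡_ (lookup π) → π ∈ 𝔖 n
  ∈𝔖⁺ {π} π-inj = ∈-filter⁺ isPermutation? (∈-allVecs π) (lookup-injective⇒Unique-toList π-inj)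

  ∈𝔖⁻ : {π : Vec (Fin n) n} → π ∈ 𝔖 n → Injective _≡_ _≡_ (lookup π)
  ∈𝔖⁻ π∈ = Unique-toList⇒lookup-injective (proj₂ (∈-filter⁻ isPermutation? {xs = allVecs n n} π∈))

  𝔇⊆𝔖 : {π : Vec (Fin n) n} → π ∈ 𝔇 n → π ∈ 𝔖 n
  𝔇⊆𝔖 π∈ = proj₁ (∈-filter⁻ isDerangement? {xs = 𝔖 n} π∈)

  reverseComplement-∈𝔖 : {π : Vec (Fin n) n} → π ∈ 𝔖 n → reverseComplement π ∈ 𝔖 n
  reverseComplement-∈𝔖 {π} π∈ = ∈𝔖⁺ (reverseComplement-injective {π = π} (∈𝔖⁻ π∈))

  reverseComplement-∈𝔇 : {π : Vec (Fin n) n} → π ∈ 𝔇 n → reverseComplement π ∈ 𝔇 n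
  reverseComplement-∈𝔇 {π} π∈ with π∈𝔖 , fixed-point-free ← ∈-filter⁻ isDerangement? {xs = 𝔖 n} π∈ =
    ∈-filter⁺ isDerangement? (reverseComplement-∈𝔖 π∈𝔖) (All.tabulate λ {j} _ →
      All.lookup fixed-point-free (∈-allFin (opposite j)) ∘ reverseComplement-fixedPoint π j)

Σℤ-sign-exc≡Σℤ-sign-excP : {m : ℕ} (Π : List (Vec (Fin (ℕ.suc m)) (ℕ.suc m))) → Unique Π →
  (∀ {π} → π ∈ Π → Injective _≡_ _≡_ (lookup π)) → (∀ {π} → π ∈ Π → reverseComplement π ∈ Π) →
  Σℤ Π (λ π → -1ℤ ^ exc π) ≡ Σℤ Π (λ π → -1ℤ ^ excP π)
Σℤ-sign-exc≡Σℤ-sign-excP Π Π! injective closed = begin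
  Σℤ Π (λ π → -1ℤ ^ exc π)                       ≡⟨ Σ.∑-cong Π same-sign ⟩
  Σℤ Π (λ π → -1ℤ ^ excP (reverseComplement π))  ≡⟨ Σ.∑-reindex (λ π → -1ℤ ^ excP π) reindexing ⟩
  Σℤ Π (λ π → -1ℤ ^ excP π)                      ∎
  where
  open ≡-Reasoning
  same-sign : ∀ {π} → π ∈ Π → -1ℤ ^ exc π ≡ -1ℤ ^ excP (reverseComplement π)
  same-sign {π} π∈ = -1^-cong-odd {exc π} {excP (reverseComplement π)}
                       (sym (odd-excP∘reverseComplement π (injective π∈)))
  reindexing : map reverseComplement Π ↭ Π
  reindexing = map-involution-↭ Π! reverseComplement-involutive closed

theorem3p1 : (n : ℕ) → n ≥ 1 →
    (Σℤ (𝔖 n) (λ π → -1ℤ ^ exc π) ≡ Σℤ (𝔖 n) (λ π → -1ℤ ^ excP π))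
    × (Σℤ (𝔇 n) (λ π → -1ℤ ^ exc π) ≡ Σℤ (𝔇 n) (λ π → -1ℤ ^ excP π))
theorem3p1 (ℕ.suc m) _ =
  Σℤ-sign-exc≡Σℤ-sign-excP {m} (𝔖 _) 𝔖-unique ∈𝔖⁻ reverseComplement-∈𝔖 ,
  Σℤ-sign-exc≡Σℤ-sign-excP {m} (𝔇 _) 𝔇-unique (∈𝔖⁻ ∘ 𝔇⊆𝔖) reverseComplement-∈𝔇
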